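{- Let $D$ be a positive integer. Define $c_i=\frac{3(D-i+1)i(D+i+1)}{D(D+2)(2i+1)}$ ($1\le i\le D$), $a_i=\frac{3i(i+1)}{D(D+2)}$ ($0\le i\le D$), $b_i=\frac{3(D-i)(i+1)(D+i+2)}{D(D+2)(2i+1)}$ ($0\le i\le D-1$), $\theta_i=3-2a_i$ ($0\le i\le D$). Let $u_0,\dots,u_D\in\mathbb R[\lambda]$ be defined by $u_0=1$, $u_1=\lambda/3$, $\lambda u_i=b_iu_{i+1}+a_iu_i+c_iu_{i-1}$ ($1\le i\le D-1$); let $k_i=\frac{b_0b_1\cdots b_{i-1}}{c_1c_2\cdots c_i}$ and $v_i(\lambda)=k_iu_i(\lambda)$ for $0\le i\le D$. Let $P$ be the $(D+1)\times(D+1)$ real matrix (rows and columns indexed by $0,\dots,D$) with entries \[P_{i,j}=(2j+1)\,{}_4F_3\!\left[\begin{matrix} -i,\ i+1,\ -j,\ j+1\\ 1,\ D+2,\ -D\end{matrix};1\right].\] Then $P_{i,j}=v_j(\theta_i)$ for all $0\le i,j\le D$.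
   Context: $(a)_n=a(a+1)\cdots(a+n-1)$, $(a)_0=1$, and ${}_4F_3\!\left[\begin{matrix} a_1,a_2,a_3,a_4\\ b_1,b_2,b_3\end{matrix};z\right]=\sum_{n\ge0}\frac{(a_1)_n(a_2)_n(a_3)_n(a_4)_n}{(b_1)_n(b_2)_n(b_3)_n}\frac{z^n}{n!}$ (here a terminating sum). -}

module Defs where

open import Data.Nat as ℕ using (ℕ; zero; suc)
open import Data.Integer as ℤ using (ℤ)
open import Data.Rational using (ℚ; 0ℚ; 1ℚ; _+_; _*_; _-_; -_; 1/_; ≢-nonZero)
open import Data.Rational.Properties using (_≟_)
open import Relation.Nullary using (yes; no)

q : ℕ → ℚ
q n = ℤ.+ n Data.Rational./ 1

-- total reciprocal (only ever applied to nonzero arguments below)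
inv : ℚ → ℚ
inv x with x ≟ 0ℚ
... | yes _ = 0ℚ
... | no x≢0 = 1/_ x {{≢-nonZero x≢0}}

_÷_ : ℚ → ℚ → ℚ
x ÷ y = x * inv y

poch : ℚ → ℕ → ℚ
poch a zero    = 1ℚ
poch a (suc n) = poch a n * (a + q n)

fact : ℕ → ℚ
fact n = poch 1ℚ n

c : ℕ → ℕ → ℚ
c D i = (q 3 * q (D ℕ.∸ i ℕ.+ 1) * q i * q (D ℕ.+ i ℕ.+ 1))
        ÷ (q D * q (D ℕ.+ 2) * q (2 ℕ.* i ℕ.+ 1))

a : ℕ → ℕ → ℚ
a D i = (q 3 * q i * q (i ℕ.+ 1)) ÷ (q D * q (D ℕ.+ 2))

b : ℕ → ℕ → ℚ
b D i = (q 3 * q (D ℕ.∸ i) * q (i ℕ.+ 1) * q (D ℕ.+ i ℕ.+ 2))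
        ÷ (q D * q (D ℕ.+ 2) * q (2 ℕ.* i ℕ.+ 1))

θ : ℕ → ℕ → ℚ
θ D i = q 3 - q 2 * a D i

u : ℕ → ℕ → ℚ → ℚ
u D zero          lam = 1ℚ
u D (suc zero)    lam = lam ÷ q 3
u D (suc (suc i)) lam =
  ((lam - a D (suc i)) * u D (suc i) lam - c D (suc i) * u D i lam) ÷ b D (suc i)

prodB : ℕ → ℕ → ℚ
prodB D zero    = 1ℚ
prodB D (suc i) = prodB D i * b D i

prodC : ℕ → ℕ → ℚ
prodC D zero    = 1ℚ
prodC D (suc i) = prodC D i * c D (suc i)

k : ℕ → ℕ → ℚ
k D i = prodB D i ÷ prodC D i

v : ℕ → ℕ → ℚ → ℚ
v D i lam = k D i * u D i lam

sumTo : ℕ → (ℕ → ℚ) → ℚ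
sumTo zero    f = 0ℚ
sumTo (suc N) f = sumTo N f + f N

F43 : ℕ → ℚ → ℚ → ℚ → ℚ → ℚ → ℚ → ℚ → ℚ → ℚ
F43 N a1 a2 a3 a4 b1 b2 b3 z =
  sumTo (suc N) λ n →
    (poch a1 n * poch a2 n * poch a3 n * poch a4 n * pow z n)
    ÷ (poch b1 n * poch b2 n * poch b3 n * fact n)
  where
  pow : ℚ → ℕ → ℚ
  pow x zero    = 1ℚ
  pow x (suc m) = pow x m * x

-- P_{i,j} = (2j+1) 4F3[-i, i+1, -j, j+1; 1, D+2, -D; 1]
-- (the series terminates: (-i)_n = 0 for n > i, and i ≤ D, so summing n = 0..D is exact
--  and avoids the vanishing denominators (-D)_n for n > D)
P : ℕ → ℕ → ℕ → ℚ
P D i j = q (2 ℕ.* j ℕ.+ 1) *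
  F43 D (- q i) (q (i ℕ.+ 1)) (- q j) (q (j ℕ.+ 1)) 1ℚ (q (D ℕ.+ 2)) (- q D) 1ℚ

{-# OPTIONS --safe #-}
-- Write P_{ij} = (2j+1) R(i,j) with
--   R(x,y) = Σ_{n≤D} (-x)_n (x+1)_n (-y)_n (y+1)_n / ((1)_n (D+2)_n (-D)_n n!).
-- Since b_m (2m+1) = c_{m+1} (2m+3), k_j = 2j+1, so it remains to show that R(i,·)
-- satisfies the recurrence defining u_j(θ_i), starting from R(i,0) = 1.  A contiguous
-- relation expresses b_y (-y-1)_n (y+2)_n + c_y (1-y)_n (y)_n through (-y)_n (y+1)_n,
-- up to a term n(n+1) (-y)_n (y+1)_n and a lagged term.  The weight
-- w_n = (-i)_n (i+1)_n / ((1)_n (D+2)_n (-D)_n n!) satisfies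
-- (n(n+1) - i(i+1)) w_n = r_n w_{n+1} with r_D = 0, so summing by parts against w
-- replaces n(n+1) by i(i+1), which is where θ_i = 3 - 6 i(i+1)/(D(D+2)) comes from.
module Submission where

open import Defs
open import Level using (0ℓ)
open import Data.Empty using (⊥-elim)
open import Data.Sum using (_⊎_; inj₁; inj₂)
open import Data.Nat as ℕ using (ℕ; zero; suc; _≤_; _<_; z≤n; s≤s)
import Data.Nat.Properties as ℕ
import Data.Integer as ℤ
import Data.Integer.Properties as ℤ
open import Data.Integer.Tactic.RingSolver using () renaming (solve-∀ to ℤ-solve-∀)
open import Data.Rational using (ℚ; 0ℚ; 1ℚ; _+_; _*_; _-_; -_; toℚᵘ; ≢-nonZero)
open import Data.Rational.Properties
import Data.Rational.Unnormalised as ℚᵘ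
import Data.Rational.Unnormalised.Properties as ℚᵘ
open import Relation.Nullary.Decidable.Core using (Dec; yes; no; dec⇒maybe)
open import Relation.Binary.PropositionalEquality
open import Tactic.RingSolver using (solve-∀)
open import Tactic.RingSolver.Core.AlmostCommutativeRing using (AlmostCommutativeRing; fromCommutativeRing)

open ≡-Reasoning

ℚ-ring : AlmostCommutativeRing 0ℓ 0ℓ
ℚ-ring = fromCommutativeRing +-*-commutativeRing (λ p → dec⇒maybe (0ℚ ≟ p))

p*inv[p]≡1 : ∀ p → p ≢ 0ℚ → p * inv p ≡ 1ℚ
p*inv[p]≡1 p p≢0 with p ≟ 0ℚ
... | yes p≡0 = ⊥-elim (p≢0 p≡0)
... | no  p≢0′ = *-inverseʳ p {{≢-nonZero p≢0′}}

p*r≢0 : ∀ {p r} → p ≢ 0ℚ → r ≢ 0ℚ → p * r ≢ 0ℚ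
p*r≢0 {p} {r} p≢0 r≢0 pr≡0 = r≢0 (begin
  r                ≡⟨ *-identityˡ r ⟨
  1ℚ * r           ≡⟨ cong (_* r) (p*inv[p]≡1 p p≢0) ⟨
  p * inv p * r    ≡⟨ regroup p (inv p) r ⟩
  inv p * (p * r)  ≡⟨ cong (inv p *_) pr≡0 ⟩
  inv p * 0ℚ       ≡⟨ *-zeroʳ (inv p) ⟩
  0ℚ               ∎)
  where
  regroup : ∀ a b c → a * b * c ≡ b * (a * c)
  regroup = solve-∀ ℚ-ring

-p≢0 : ∀ {p} → p ≢ 0ℚ → - p ≢ 0ℚ
-p≢0 p≢0 -p≡0 = p≢0 (neg-injective -p≡0)

inv-unique : ∀ p r → p * r ≡ 1ℚ → inv p ≡ r
inv-unique p r pr≡1 = begin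
  inv p              ≡⟨ *-identityʳ (inv p) ⟨
  inv p * 1ℚ         ≡⟨ cong (inv p *_) pr≡1 ⟨
  inv p * (p * r)    ≡⟨ regroup (inv p) p r ⟩
  (p * inv p) * r    ≡⟨ cong (_* r) (p*inv[p]≡1 p p≢0) ⟩
  1ℚ * r             ≡⟨ *-identityˡ r ⟩
  r                  ∎
  where
  p≢0 : p ≢ 0ℚ
  p≢0 refl = 1≢0 (trans (sym pr≡1) (*-zeroˡ r))
  regroup : ∀ a b c → a * (b * c) ≡ (b * a) * c
  regroup = solve-∀ ℚ-ring

inv-distrib-* : ∀ p r → inv (p * r) ≡ inv p * inv r
inv-distrib-* p r = by-cases (p ≟ 0ℚ) (r ≟ 0ℚ)
  where
  regroup : ∀ a b c d → a * b * (c * d) ≡ (a * c) * (b * d)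
  regroup = solve-∀ ℚ-ring
  by-cases : Dec (p ≡ 0ℚ) → Dec (r ≡ 0ℚ) → inv (p * r) ≡ inv p * inv r
  by-cases (yes p≡0) _ = begin
    inv (p * r)      ≡⟨ cong (λ z → inv (z * r)) p≡0 ⟩
    inv (0ℚ * r)     ≡⟨ cong inv (*-zeroˡ r) ⟩
    0ℚ               ≡⟨ *-zeroˡ (inv r) ⟨
    inv 0ℚ * inv r   ≡⟨ cong (λ z → inv z * inv r) p≡0 ⟨
    inv p * inv r    ∎
  by-cases (no _) (yes r≡0) = begin
    inv (p * r)      ≡⟨ cong (λ z → inv (p * z)) r≡0 ⟩
    inv (p * 0ℚ)     ≡⟨ cong inv (*-zeroʳ p) ⟩
    0ℚ               ≡⟨ *-zeroʳ (inv p) ⟨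
    inv p * inv 0ℚ   ≡⟨ cong (λ z → inv p * inv z) r≡0 ⟨
    inv p * inv r    ∎
  by-cases (no p≢0) (no r≢0) = inv-unique (p * r) (inv p * inv r) (begin
    p * r * (inv p * inv r)        ≡⟨ regroup p r (inv p) (inv r) ⟩
    (p * inv p) * (r * inv r)      ≡⟨ cong₂ _*_ (p*inv[p]≡1 p p≢0) (p*inv[p]≡1 r r≢0) ⟩
    1ℚ                             ∎)

p÷r≢0 : ∀ {p r} → p ≢ 0ℚ → r ≢ 0ℚ → p ÷ r ≢ 0ℚ
p÷r≢0 {r = r} p≢0 r≢0 = p*r≢0 p≢0 inv[r]≢0
  where
  inv[r]≢0 : inv r ≢ 0ℚ
  inv[r]≢0 inv[r]≡0 = 1≢0 (trans (sym (p*inv[p]≡1 r r≢0)) (trans (cong (r *_) inv[r]≡0) (*-zeroʳ r)))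

p*s≡t⇒s≡t÷p : ∀ {p s t} → p ≢ 0ℚ → p * s ≡ t → s ≡ t ÷ p
p*s≡t⇒s≡t÷p {p} {s} {t} p≢0 ps≡t = begin
  s                  ≡⟨ *-identityʳ s ⟨
  s * 1ℚ             ≡⟨ cong (s *_) (p*inv[p]≡1 p p≢0) ⟨
  s * (p * inv p)    ≡⟨ regroup s p (inv p) ⟩
  (p * s) * inv p    ≡⟨ cong (_* inv p) ps≡t ⟩
  t ÷ p              ∎
  where
  regroup : ∀ a b c → a * (b * c) ≡ (b * a) * c
  regroup = solve-∀ ℚ-ring

p÷[r*s]*s≡p÷r : ∀ p r {s} → s ≢ 0ℚ → (p ÷ (r * s)) * s ≡ p ÷ r
p÷[r*s]*s≡p÷r p r {s} s≢0 = begin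
  p * inv (r * s) * s          ≡⟨ cong (λ z → p * z * s) (inv-distrib-* r s) ⟩
  p * (inv r * inv s) * s      ≡⟨ regroup p (inv r) (inv s) s ⟩
  p * inv r * (s * inv s)      ≡⟨ cong (p * inv r *_) (p*inv[p]≡1 s s≢0) ⟩
  p * inv r * 1ℚ               ≡⟨ *-identityʳ (p * inv r) ⟩
  p ÷ r                        ∎
  where
  regroup : ∀ a b c d → a * (b * c) * d ≡ a * b * (d * c)
  regroup = solve-∀ ℚ-ring

recurrence-÷ : ∀ e B C {o K G₊ G G₋} → o ≢ 0ℚ → B * G₊ + C * G₋ ≡ o * K * G →
  (B ÷ (e * o)) * G₊ ≡ (K ÷ e) * G - (C ÷ (e * o)) * G₋
recurrence-÷ e B C {o} {K} {G₊} {G} {G₋} o≢0 eq = begin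
  B * κ * G₊                                  ≡⟨ split B C κ G₊ G₋ ⟩
  κ * (B * G₊ + C * G₋) - C * κ * G₋          ≡⟨ cong (λ z → κ * z - C * κ * G₋) eq ⟩
  κ * (o * K * G) - C * κ * G₋                ≡⟨ cong (λ z → z * (o * K * G) - C * κ * G₋) (inv-distrib-* e o) ⟩
  inv e * inv o * (o * K * G) - C * κ * G₋    ≡⟨ regroup (inv e) (inv o) o K G (C * κ * G₋) ⟩
  (o * inv o) * (K * inv e * G) - C * κ * G₋  ≡⟨ cong (λ z → z * (K * inv e * G) - C * κ * G₋) (p*inv[p]≡1 o o≢0) ⟩
  1ℚ * (K * inv e * G) - C * κ * G₋           ≡⟨ cong (_- C * κ * G₋) (*-identityˡ (K * inv e * G)) ⟩
  K * inv e * G - C * κ * G₋                  ∎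
  where
  κ = inv (e * o)
  split : ∀ B C κ G₊ G₋ → B * κ * G₊ ≡ κ * (B * G₊ + C * G₋) - C * κ * G₋
  split = solve-∀ ℚ-ring
  regroup : ∀ ε ι o K G t → ε * ι * (o * K * G) - t ≡ (o * ι) * (K * ε * G) - t
  regroup = solve-∀ ℚ-ring

private
  ℕ→ℚᵘ : ℕ → ℚᵘ.ℚᵘ
  ℕ→ℚᵘ n = ℚᵘ.mkℚᵘ (ℤ.+ n) 0

  toℚᵘ-q : ∀ n → toℚᵘ (q n) ℚᵘ.≃ ℕ→ℚᵘ n
  toℚᵘ-q n = toℚᵘ-fromℚᵘ (ℕ→ℚᵘ n)

q-+ : ∀ m n → q (m ℕ.+ n) ≡ q m + q n
q-+ m n = toℚᵘ-injective (ℚᵘ.≃-trans (toℚᵘ-q (m ℕ.+ n)) (ℚᵘ.≃-trans (ℚᵘ.*≡* numerators)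
  (ℚᵘ.≃-sym (ℚᵘ.≃-trans (toℚᵘ-homo-+ (q m) (q n)) (ℚᵘ.+-cong (toℚᵘ-q m) (toℚᵘ-q n))))))
  where
  ring : ∀ a b → (a ℤ.+ b) ℤ.* (ℤ.+ 1 ℤ.* ℤ.+ 1) ≡ (a ℤ.* ℤ.+ 1 ℤ.+ b ℤ.* ℤ.+ 1) ℤ.* ℤ.+ 1
  ring = ℤ-solve-∀
  numerators : ℤ.+ (m ℕ.+ n) ℤ.* (ℤ.+ 1 ℤ.* ℤ.+ 1) ≡ (ℤ.+ m ℤ.* ℤ.+ 1 ℤ.+ ℤ.+ n ℤ.* ℤ.+ 1) ℤ.* ℤ.+ 1
  numerators = trans (cong (ℤ._* (ℤ.+ 1 ℤ.* ℤ.+ 1)) (ℤ.pos-+ m n)) (ring (ℤ.+ m) (ℤ.+ n))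

q-* : ∀ m n → q (m ℕ.* n) ≡ q m * q n
q-* m n = toℚᵘ-injective (ℚᵘ.≃-trans (toℚᵘ-q (m ℕ.* n)) (ℚᵘ.≃-trans (ℚᵘ.*≡* numerators)
  (ℚᵘ.≃-sym (ℚᵘ.≃-trans (toℚᵘ-homo-* (q m) (q n)) (ℚᵘ.*-cong (toℚᵘ-q m) (toℚᵘ-q n))))))
  where
  ring : ∀ a b → (a ℤ.* b) ℤ.* (ℤ.+ 1 ℤ.* ℤ.+ 1) ≡ (a ℤ.* b) ℤ.* ℤ.+ 1
  ring = ℤ-solve-∀
  numerators : ℤ.+ (m ℕ.* n) ℤ.* (ℤ.+ 1 ℤ.* ℤ.+ 1) ≡ (ℤ.+ m ℤ.* ℤ.+ n) ℤ.* ℤ.+ 1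
  numerators = trans (cong (ℤ._* (ℤ.+ 1 ℤ.* ℤ.+ 1)) (ℤ.pos-* m n)) (ring (ℤ.+ m) (ℤ.+ n))

q-suc : ∀ n → q (suc n) ≡ q n + 1ℚ
q-suc n = trans (cong q (ℕ.+-comm 1 n)) (q-+ n 1)

q-∸ : ∀ {m n} → n ≤ m → q (m ℕ.∸ n) ≡ q m - q n
q-∸ {m} {n} n≤m = begin
  q (m ℕ.∸ n)                ≡⟨ cancel (q (m ℕ.∸ n)) (q n) ⟩
  q (m ℕ.∸ n) + q n - q n    ≡⟨ cong (_- q n) (q-+ (m ℕ.∸ n) n) ⟨
  q (m ℕ.∸ n ℕ.+ n) - q n    ≡⟨ cong (λ k → q k - q n) (ℕ.m∸n+n≡m n≤m) ⟩
  q m - q n                  ∎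
  where
  cancel : ∀ a b → a ≡ a + b - b
  cancel = solve-∀ ℚ-ring

q-≢0 : ∀ {n} → 0 < n → q n ≢ 0ℚ
q-≢0 {suc n} _ q[1+n]≡0 with ℚᵘ.≃-trans (ℚᵘ.≃-sym (toℚᵘ-q (suc n))) (ℚᵘ.≃-reflexive (cong toℚᵘ q[1+n]≡0))
... | ℚᵘ.*≡* ()

0<m+[1+n] : ∀ m n → 0 < m ℕ.+ suc n
0<m+[1+n] m n = subst (0 <_) (sym (ℕ.+-suc m n)) (s≤s z≤n)

sumTo-cong : ∀ N {f g : ℕ → ℚ} → (∀ n → n < N → f n ≡ g n) → sumTo N f ≡ sumTo N g
sumTo-cong zero    f≡g = refl
sumTo-cong (suc N) f≡g =
  cong₂ _+_ (sumTo-cong N (λ n n<N → f≡g n (ℕ.m<n⇒m<1+n n<N))) (f≡g N (ℕ.n<1+n N))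

sumTo-+ : ∀ N (f g : ℕ → ℚ) → sumTo N (λ n → f n + g n) ≡ sumTo N f + sumTo N g
sumTo-+ zero    f g = refl
sumTo-+ (suc N) f g = trans (cong (_+ (f N + g N)) (sumTo-+ N f g)) (regroup (sumTo N f) (sumTo N g) (f N) (g N))
  where
  regroup : ∀ a b c d → a + b + (c + d) ≡ a + c + (b + d)
  regroup = solve-∀ ℚ-ring

sumTo-*ˡ : ∀ N c (f : ℕ → ℚ) → sumTo N (λ n → c * f n) ≡ c * sumTo N f
sumTo-*ˡ zero    c f = sym (*-zeroʳ c)
sumTo-*ˡ (suc N) c f = trans (cong (_+ c * f N) (sumTo-*ˡ N c f)) (sym (*-distribˡ-+ c (sumTo N f) (f N)))

sumTo-linear : ∀ N α β (f g : ℕ → ℚ) →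
  sumTo N (λ n → α * f n + β * g n) ≡ α * sumTo N f + β * sumTo N g
sumTo-linear N α β f g =
  trans (sumTo-+ N (λ n → α * f n) (λ n → β * g n)) (cong₂ _+_ (sumTo-*ˡ N α f) (sumTo-*ˡ N β g))

sumTo-telescope : ∀ N (h : ℕ → ℚ) → sumTo N (λ n → h (suc n) - h n) ≡ h N - h 0
sumTo-telescope zero    h = sym (+-inverseʳ (h 0))
sumTo-telescope (suc N) h =
  trans (cong (_+ (h (suc N) - h N)) (sumTo-telescope N h)) (collapse (h 0) (h N) (h (suc N)))
  where
  collapse : ∀ a b c → b - a + (c - b) ≡ c - a
  collapse = solve-∀ ℚ-ring

sumTo-single : ∀ N (f : ℕ → ℚ) → (∀ n → f (suc n) ≡ 0ℚ) → sumTo (suc N) f ≡ f 0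
sumTo-single zero    f _     = +-identityˡ (f 0)
sumTo-single (suc N) f f[1+]≡0 =
  trans (cong₂ _+_ (sumTo-single N f f[1+]≡0) (f[1+]≡0 N)) (+-identityʳ (f 0))

poch-sucˡ : ∀ a n → poch a (suc n) ≡ a * poch (a + 1ℚ) n
poch-sucˡ a zero    = unit a
  where
  unit : ∀ a → 1ℚ * (a + q 0) ≡ a * 1ℚ
  unit = solve-∀ ℚ-ring
poch-sucˡ a (suc n) = begin
  poch a (suc n) * (a + q (suc n))            ≡⟨ cong₂ (λ p k → p * (a + k)) (poch-sucˡ a n) (q-suc n) ⟩
  a * poch (a + 1ℚ) n * (a + (q n + 1ℚ))      ≡⟨ regroup a (poch (a + 1ℚ) n) (q n) ⟩
  a * (poch (a + 1ℚ) n * (a + 1ℚ + q n))      ∎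
  where
  regroup : ∀ a p k → a * p * (a + (k + 1ℚ)) ≡ a * (p * (a + 1ℚ + k))
  regroup = solve-∀ ℚ-ring

poch-sucsucˡ : ∀ a n → poch a (suc (suc n)) ≡ a * (a + 1ℚ) * poch (a + 1ℚ + 1ℚ) n
poch-sucsucˡ a n = trans (poch-sucˡ a (suc n))
  (trans (cong (a *_) (poch-sucˡ (a + 1ℚ) n)) (sym (*-assoc a (a + 1ℚ) (poch (a + 1ℚ + 1ℚ) n))))

poch-sucsucʳ : ∀ a n → poch a (suc (suc n)) ≡ poch a n * (a + q n) * (a + q n + 1ℚ)
poch-sucsucʳ a n = cong (poch a n * (a + q n) *_) (trans (cong (a +_) (q-suc n)) (sym (+-assoc a (q n) 1ℚ)))

poch-vanishes : ∀ {a k} n → a + q k ≡ 0ℚ → k < n → poch a n ≡ 0ℚ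
poch-vanishes {a} {k} (suc n) a+k≡0 k<1+n with ℕ.m≤n⇒m<n∨m≡n (ℕ.≤-pred k<1+n)
... | inj₁ k<n  = trans (cong (_* (a + q n)) (poch-vanishes n a+k≡0 k<n)) (*-zeroˡ (a + q n))
... | inj₂ refl = trans (cong (poch a n *_) a+k≡0) (*-zeroʳ (poch a n))

pronic : ℚ → ℚ
pronic y = y * (y + 1ℚ)

A : ℚ → ℕ → ℚ
A y n = poch (- y) n * poch (y + 1ℚ) n

A-suc : ∀ y n → A y (suc n) ≡ (pronic (q n) - pronic y) * A y n
A-suc y n = factor (poch (- y) n) (poch (y + 1ℚ) n) y (q n)
  where
  factor : ∀ P Q y k → P * (- y + k) * (Q * (y + 1ℚ + k)) ≡ (k * (k + 1ℚ) - y * (y + 1ℚ)) * (P * Q)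
  factor = solve-∀ ℚ-ring

A-vanishes : ∀ {k} n → k < n → A (q k) n ≡ 0ℚ
A-vanishes {k} n k<n =
  trans (cong (_* poch (q k + 1ℚ) n) (poch-vanishes n (+-inverseˡ (q k)) k<n)) (*-zeroˡ (poch (q k + 1ℚ) n))

ρ : ℚ → ℕ → ℚ
ρ d n = poch 1ℚ n * poch (d + q 2) n * poch (- d) n * fact n

r : ℚ → ℕ → ℚ
r d n = (1ℚ + q n) * (d + q 2 + q n) * (- d + q n) * (1ℚ + q n)

ρ-suc : ∀ d n → ρ d (suc n) ≡ ρ d n * r d n
ρ-suc d n = regroup (poch 1ℚ n) (poch (d + q 2) n) (poch (- d) n) (1ℚ + q n) (d + q 2 + q n) (- d + q n)
  where
  regroup : ∀ a b c u v w → (a * u) * (b * v) * (c * w) * (a * u) ≡ (a * b * c * a) * (u * v * w * u)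
  regroup = solve-∀ ℚ-ring

lag : (ℕ → ℚ) → (ℕ → ℚ) → ℕ → ℚ
lag s f zero    = 0ℚ
lag s f (suc n) = f n * s n

-- The contiguous relation in y

bNum : ℚ → ℚ → ℚ
bNum d y = q 3 * (d - y) * (y + 1ℚ) * (d + y + q 2)

cNum : ℚ → ℚ → ℚ
cNum d y = q 3 * (d - y + 1ℚ) * y * (d + y + 1ℚ)

E : ℚ → ℚ
E d = d * (d + q 2)

odd : ℚ → ℚ
odd y = q 2 * y + 1ℚ

A-contiguous : ∀ d y n →
  bNum d y * A (y + 1ℚ) n + cNum d y * A (y - 1ℚ) n
  ≡ odd y * ((q 3 * E d - q 3 * pronic y) * A y n - q 6 * (pronic (q n) * A y n - lag (r d) (A y) n))
A-contiguous d y zero = polynomial d y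
  where
  polynomial : ∀ d y →
    let a = 1ℚ * 1ℚ in
    q 3 * (d - y) * (y + 1ℚ) * (d + y + q 2) * a + q 3 * (d - y + 1ℚ) * y * (d + y + 1ℚ) * a
    ≡ (q 2 * y + 1ℚ) * ((q 3 * (d * (d + q 2)) - q 3 * (y * (y + 1ℚ))) * a - q 6 * (q 0 * (q 0 + 1ℚ) * a - 0ℚ))
  polynomial = solve-∀ ℚ-ring
A-contiguous d y (suc zero) = polynomial d y
  where
  polynomial : ∀ d y →
    let a₊ = (1ℚ * (- (y + 1ℚ) + q 0)) * (1ℚ * (y + 1ℚ + 1ℚ + q 0))
        a₋ = (1ℚ * (- (y - 1ℚ) + q 0)) * (1ℚ * (y - 1ℚ + 1ℚ + q 0))
        a₀ = (1ℚ * (- y + q 0)) * (1ℚ * (y + 1ℚ + q 0))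
        s  = (1ℚ * 1ℚ) * ((1ℚ + q 0) * (d + q 2 + q 0) * (- d + q 0) * (1ℚ + q 0)) in
    q 3 * (d - y) * (y + 1ℚ) * (d + y + q 2) * a₊ + q 3 * (d - y + 1ℚ) * y * (d + y + 1ℚ) * a₋
    ≡ (q 2 * y + 1ℚ) * ((q 3 * (d * (d + q 2)) - q 3 * (y * (y + 1ℚ))) * a₀ - q 6 * (q 1 * (q 1 + 1ℚ) * a₀ - s))
  polynomial = solve-∀ ℚ-ring
-- For n ≥ 2 all four terms are multiples of (1-y)_{n-2} (y+2)_{n-2}.
A-contiguous d y (suc (suc m)) = begin
  bNum d y * A (y + 1ℚ) (suc (suc m)) + cNum d y * A (y - 1ℚ) (suc (suc m))
    ≡⟨ cong₂ (λ a₊ a₋ → bNum d y * a₊ + cNum d y * a₋) A₊ A₋ ⟩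
  _ ≡⟨ polynomial d y μ W V ⟩
  _ ≡⟨ cong₂ (λ a₀ s → rhs a₀ s (pronic (μ + 1ℚ + 1ℚ))) A₀ lag₀ ⟨
  _ ≡⟨ cong (rhs (A y (suc (suc m))) (lag (r d) (A y) (suc (suc m)))) pronic[m+2] ⟨
  rhs (A y (suc (suc m))) (lag (r d) (A y) (suc (suc m))) (pronic (q (suc (suc m)))) ∎
  where
  rhs : ℚ → ℚ → ℚ → ℚ
  rhs a₀ s ν = odd y * ((q 3 * E d - q 3 * pronic y) * a₀ - q 6 * (ν * a₀ - s))

  W = poch (- y + 1ℚ) m
  V = poch (y + 1ℚ + 1ℚ) m
  μ = q m

  shift₊ : ∀ y → - (y + 1ℚ) + 1ℚ + 1ℚ ≡ - y + 1ℚ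
  shift₊ = solve-∀ ℚ-ring
  shift₋ : ∀ y → - (y - 1ℚ) ≡ - y + 1ℚ
  shift₋ = solve-∀ ℚ-ring
  shift₋′ : ∀ y → y - 1ℚ + 1ℚ + 1ℚ + 1ℚ ≡ y + 1ℚ + 1ℚ
  shift₋′ = solve-∀ ℚ-ring

  A₊ : A (y + 1ℚ) (suc (suc m)) ≡ (- (y + 1ℚ)) * (- (y + 1ℚ) + 1ℚ) * W * (V * (y + 1ℚ + 1ℚ + μ) * (y + 1ℚ + 1ℚ + μ + 1ℚ))
  A₊ = cong₂ _*_
    (trans (poch-sucsucˡ (- (y + 1ℚ)) m) (cong (λ c → - (y + 1ℚ) * (- (y + 1ℚ) + 1ℚ) * poch c m) (shift₊ y)))
    (poch-sucsucʳ (y + 1ℚ + 1ℚ) m)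

  A₀ : A y (suc (suc m)) ≡ (- y) * (W * (- y + 1ℚ + μ)) * ((y + 1ℚ) * (V * (y + 1ℚ + 1ℚ + μ)))
  A₀ = cong₂ _*_ (poch-sucˡ (- y) (suc m)) (poch-sucˡ (y + 1ℚ) (suc m))

  A₋ : A (y - 1ℚ) (suc (suc m))
     ≡ W * (- (y - 1ℚ) + μ) * (- (y - 1ℚ) + μ + 1ℚ) * ((y - 1ℚ + 1ℚ) * (y - 1ℚ + 1ℚ + 1ℚ) * V)
  A₋ = cong₂ _*_
    (trans (poch-sucsucʳ (- (y - 1ℚ)) m) (cong (λ c → poch c m * (- (y - 1ℚ) + μ) * (- (y - 1ℚ) + μ + 1ℚ)) (shift₋ y)))
    (trans (poch-sucsucˡ (y - 1ℚ + 1ℚ) m) (cong (λ c → (y - 1ℚ + 1ℚ) * (y - 1ℚ + 1ℚ + 1ℚ) * poch c m) (shift₋′ y)))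

  lag₀ : lag (r d) (A y) (suc (suc m))
       ≡ (- y) * W * ((y + 1ℚ) * V) * ((1ℚ + (μ + 1ℚ)) * (d + q 2 + (μ + 1ℚ)) * (- d + (μ + 1ℚ)) * (1ℚ + (μ + 1ℚ)))
  lag₀ = cong₂ _*_ (cong₂ _*_ (poch-sucˡ (- y) m) (poch-sucˡ (y + 1ℚ) m))
                   (cong (λ k → (1ℚ + k) * (d + q 2 + k) * (- d + k) * (1ℚ + k)) (q-suc m))

  pronic[m+2] : pronic (q (suc (suc m))) ≡ pronic (μ + 1ℚ + 1ℚ)
  pronic[m+2] = cong pronic (trans (q-suc (suc m)) (cong (_+ 1ℚ) (q-suc m)))

  polynomial : ∀ d y μ W V →
    let a₊ = (- (y + 1ℚ)) * (- (y + 1ℚ) + 1ℚ) * W * (V * (y + 1ℚ + 1ℚ + μ) * (y + 1ℚ + 1ℚ + μ + 1ℚ))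
        a₀ = (- y) * (W * (- y + 1ℚ + μ)) * ((y + 1ℚ) * (V * (y + 1ℚ + 1ℚ + μ)))
        a₋ = W * (- (y - 1ℚ) + μ) * (- (y - 1ℚ) + μ + 1ℚ) * ((y - 1ℚ + 1ℚ) * (y - 1ℚ + 1ℚ + 1ℚ) * V)
        s  = (- y) * W * ((y + 1ℚ) * V) * ((1ℚ + (μ + 1ℚ)) * (d + q 2 + (μ + 1ℚ)) * (- d + (μ + 1ℚ)) * (1ℚ + (μ + 1ℚ)))
        ν  = (μ + 1ℚ + 1ℚ) * (μ + 1ℚ + 1ℚ + 1ℚ) in
    q 3 * (d - y) * (y + 1ℚ) * (d + y + q 2) * a₊ + q 3 * (d - y + 1ℚ) * y * (d + y + 1ℚ) * a₋
    ≡ (q 2 * y + 1ℚ) * ((q 3 * (d * (d + q 2)) - q 3 * (y * (y + 1ℚ))) * a₀ - q 6 * (ν * a₀ - s))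
  polynomial = solve-∀ ℚ-ring

-- Summation by parts against the weight

module _ (D : ℕ) where

  weight : ℚ → ℕ → ℚ
  weight x n = A x n ÷ ρ (q D) n

  R : ℚ → ℚ → ℚ
  R x y = sumTo (suc D) (λ n → A y n * weight x n)

  r-≢0 : ∀ {n} → n < D → r (q D) n ≢ 0ℚ
  r-≢0 {n} n<D = p*r≢0 (p*r≢0 (p*r≢0 1+n≢0 D+2+n≢0) n-D≢0) 1+n≢0
    where
    1+n≢0 : 1ℚ + q n ≢ 0ℚ
    1+n≢0 = subst (_≢ 0ℚ) (trans (q-suc n) (+-comm (q n) 1ℚ)) (q-≢0 {suc n} ℕ.z<s)
    D+2+n≢0 : q D + q 2 + q n ≢ 0ℚ
    D+2+n≢0 = subst (_≢ 0ℚ) (trans (q-+ (D ℕ.+ 2) n) (cong (_+ q n) (q-+ D 2)))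
                (q-≢0 (ℕ.<-≤-trans (0<m+[1+n] D 1) (ℕ.m≤m+n (D ℕ.+ 2) n)))
    n-D≢0 : - q D + q n ≢ 0ℚ
    n-D≢0 = subst (_≢ 0ℚ) (trans (cong -_ (q-∸ (ℕ.<⇒≤ n<D))) (negate (q D) (q n)))
              (-p≢0 (q-≢0 (ℕ.m<n⇒0<n∸m n<D)))
      where
      negate : ∀ a b → - (a - b) ≡ - a + b
      negate = solve-∀ ℚ-ring

  r-D≡0 : r (q D) D ≡ 0ℚ
  r-D≡0 = begin
    (1ℚ + q D) * (q D + q 2 + q D) * (- q D + q D) * (1ℚ + q D)
      ≡⟨ cong (λ z → (1ℚ + q D) * (q D + q 2 + q D) * z * (1ℚ + q D)) (+-inverseˡ (q D)) ⟩
    (1ℚ + q D) * (q D + q 2 + q D) * 0ℚ * (1ℚ + q D)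
      ≡⟨ annihilate ((1ℚ + q D) * (q D + q 2 + q D)) (1ℚ + q D) ⟩
    0ℚ ∎
    where
    annihilate : ∀ a b → a * 0ℚ * b ≡ 0ℚ
    annihilate = solve-∀ ℚ-ring

  weight-suc : ∀ {i n} → i ≤ D → n ≤ D →
    (pronic (q n) - pronic (q i)) * weight (q i) n ≡ r (q D) n * weight (q i) (suc n)
  weight-suc {i} {n} i≤D n≤D = begin
    (pronic (q n) - pronic (q i)) * (A (q i) n * inv (ρ (q D) n))
      ≡⟨ *-assoc (pronic (q n) - pronic (q i)) (A (q i) n) (inv (ρ (q D) n)) ⟨
    (pronic (q n) - pronic (q i)) * A (q i) n * inv (ρ (q D) n)
      ≡⟨ cong (_* inv (ρ (q D) n)) (A-suc (q i) n) ⟨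
    A (q i) (suc n) * inv (ρ (q D) n)
      ≡⟨ shifted (ℕ.m≤n⇒m<n∨m≡n n≤D) ⟩
    r (q D) n * weight (q i) (suc n) ∎
    where
    shifted : n < D ⊎ n ≡ D → A (q i) (suc n) * inv (ρ (q D) n) ≡ r (q D) n * weight (q i) (suc n)
    shifted (inj₁ n<D) = sym (begin
      r (q D) n * (A (q i) (suc n) * inv (ρ (q D) (suc n)))
        ≡⟨ cong (λ z → r (q D) n * (A (q i) (suc n) * inv z)) (ρ-suc (q D) n) ⟩
      r (q D) n * (A (q i) (suc n) * inv (ρ (q D) n * r (q D) n))
        ≡⟨ cong (λ z → r (q D) n * (A (q i) (suc n) * z)) (inv-distrib-* (ρ (q D) n) (r (q D) n)) ⟩
      r (q D) n * (A (q i) (suc n) * (inv (ρ (q D) n) * inv (r (q D) n)))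
        ≡⟨ regroup (r (q D) n) (A (q i) (suc n)) (inv (ρ (q D) n)) (inv (r (q D) n)) ⟩
      A (q i) (suc n) * inv (ρ (q D) n) * (r (q D) n * inv (r (q D) n))
        ≡⟨ cong (A (q i) (suc n) * inv (ρ (q D) n) *_) (p*inv[p]≡1 (r (q D) n) (r-≢0 n<D)) ⟩
      A (q i) (suc n) * inv (ρ (q D) n) * 1ℚ
        ≡⟨ *-identityʳ (A (q i) (suc n) * inv (ρ (q D) n)) ⟩
      A (q i) (suc n) * inv (ρ (q D) n) ∎)
      where
      regroup : ∀ a b c d → a * (b * (c * d)) ≡ b * c * (a * d)
      regroup = solve-∀ ℚ-ring
    shifted (inj₂ refl) = begin
      A (q i) (suc D) * inv (ρ (q D) D)    ≡⟨ cong (_* inv (ρ (q D) D)) (A-vanishes (suc D) (s≤s i≤D)) ⟩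
      0ℚ * inv (ρ (q D) D)                 ≡⟨ *-zeroˡ (inv (ρ (q D) D)) ⟩
      0ℚ                                   ≡⟨ *-zeroˡ (weight (q i) (suc D)) ⟨
      0ℚ * weight (q i) (suc D)            ≡⟨ cong (_* weight (q i) (suc D)) r-D≡0 ⟨
      r (q D) D * weight (q i) (suc D)     ∎

  summation-by-parts : ∀ {i} → i ≤ D → ∀ (f : ℕ → ℚ) →
    sumTo (suc D) (λ n → (pronic (q n) * f n - lag (r (q D)) f n) * weight (q i) n)
    ≡ pronic (q i) * sumTo (suc D) (λ n → f n * weight (q i) n)
  summation-by-parts {i} i≤D f = begin
    sumTo (suc D) (λ n → (pronic (q n) * f n - lag (r (q D)) f n) * w n)
      ≡⟨ sumTo-cong (suc D) (λ n n<1+D → pointwise n (ℕ.≤-pred n<1+D)) ⟩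
    sumTo (suc D) (λ n → pronic x * (f n * w n) + (h (suc n) - h n))
      ≡⟨ sumTo-+ (suc D) (λ n → pronic x * (f n * w n)) (λ n → h (suc n) - h n) ⟩
    sumTo (suc D) (λ n → pronic x * (f n * w n)) + sumTo (suc D) (λ n → h (suc n) - h n)
      ≡⟨ cong₂ _+_ (sumTo-*ˡ (suc D) (pronic x) (λ n → f n * w n)) (sumTo-telescope (suc D) h) ⟩
    pronic x * Σfw + (h (suc D) - h 0)
      ≡⟨ cong₂ (λ a b → pronic x * Σfw + (a - b)) h[1+D]≡0 (*-zeroˡ (w 0)) ⟩
    pronic x * Σfw + 0ℚ
      ≡⟨ +-identityʳ (pronic x * Σfw) ⟩
    pronic x * Σfw ∎
    where
    x = q i
    w = weight x
    Σfw = sumTo (suc D) (λ n → f n * w n)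
    h : ℕ → ℚ
    h n = lag (r (q D)) f n * w n

    split : ∀ νₙ νₓ a s v → (νₙ * a - s) * v ≡ νₓ * (a * v) + (a * ((νₙ - νₓ) * v) - s * v)
    split = solve-∀ ℚ-ring

    pointwise : ∀ n → n ≤ D →
      (pronic (q n) * f n - lag (r (q D)) f n) * w n ≡ pronic x * (f n * w n) + (h (suc n) - h n)
    pointwise n n≤D = begin
      (pronic (q n) * f n - lag (r (q D)) f n) * w n
        ≡⟨ split (pronic (q n)) (pronic x) (f n) (lag (r (q D)) f n) (w n) ⟩
      pronic x * (f n * w n) + (f n * ((pronic (q n) - pronic x) * w n) - h n)
        ≡⟨ cong (λ z → pronic x * (f n * w n) + (f n * z - h n)) (weight-suc i≤D n≤D) ⟩
      pronic x * (f n * w n) + (f n * (r (q D) n * w (suc n)) - h n)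
        ≡⟨ cong (λ z → pronic x * (f n * w n) + (z - h n)) (*-assoc (f n) (r (q D) n) (w (suc n))) ⟨
      pronic x * (f n * w n) + (h (suc n) - h n) ∎

    h[1+D]≡0 : h (suc D) ≡ 0ℚ
    h[1+D]≡0 = begin
      f D * r (q D) D * w (suc D)    ≡⟨ cong (λ z → f D * z * w (suc D)) r-D≡0 ⟩
      f D * 0ℚ * w (suc D)           ≡⟨ cong (_* w (suc D)) (*-zeroʳ (f D)) ⟩
      0ℚ * w (suc D)                 ≡⟨ *-zeroˡ (w (suc D)) ⟩
      0ℚ                             ∎

  R-at-0 : ∀ x → R x (q 0) ≡ 1ℚ
  R-at-0 x = sumTo-single D (λ n → A (q 0) n * weight x n)
    (λ n → trans (cong (_* weight x (suc n)) (A-vanishes (suc n) ℕ.z<s)) (*-zeroˡ (weight x (suc n))))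

  R-recurrence : ∀ {i} → i ≤ D → ∀ y →
    bNum (q D) y * R (q i) (y + 1ℚ) + cNum (q D) y * R (q i) (y - 1ℚ)
    ≡ odd y * (q 3 * E (q D) - q 3 * pronic y - q 6 * pronic (q i)) * R (q i) y
  R-recurrence {i} i≤D y = begin
    bNum (q D) y * R x (y + 1ℚ) + cNum (q D) y * R x (y - 1ℚ)
      ≡⟨ sumTo-linear (suc D) (bNum (q D) y) (cNum (q D) y) (λ n → A (y + 1ℚ) n * w n) (λ n → A (y - 1ℚ) n * w n) ⟨
    sumTo (suc D) (λ n → bNum (q D) y * (A (y + 1ℚ) n * w n) + cNum (q D) y * (A (y - 1ℚ) n * w n))
      ≡⟨ sumTo-cong (suc D) (λ n _ → pointwise n) ⟩
    sumTo (suc D) (λ n → α * (A y n * w n) + β * (Λ n * w n))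
      ≡⟨ sumTo-linear (suc D) α β (λ n → A y n * w n) (λ n → Λ n * w n) ⟩
    α * R x y + β * sumTo (suc D) (λ n → Λ n * w n)
      ≡⟨ cong (λ z → α * R x y + β * z) (summation-by-parts i≤D (A y)) ⟩
    α * R x y + β * (pronic x * R x y)
      ≡⟨ collect (odd y) (E (q D)) (pronic y) (pronic x) (R x y) ⟩
    odd y * (q 3 * E (q D) - q 3 * pronic y - q 6 * pronic x) * R x y ∎
    where
    x = q i
    w = weight x
    α = odd y * (q 3 * E (q D) - q 3 * pronic y)
    β = - (q 6 * odd y)
    Λ : ℕ → ℚ
    Λ n = pronic (q n) * A y n - lag (r (q D)) (A y) n

    distrib : ∀ b c a₊ a₋ v → b * (a₊ * v) + c * (a₋ * v) ≡ (b * a₊ + c * a₋) * v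
    distrib = solve-∀ ℚ-ring
    redistrib : ∀ o k a t v → o * (k * a - q 6 * t) * v ≡ o * k * (a * v) + (- (q 6 * o)) * (t * v)
    redistrib = solve-∀ ℚ-ring
    collect : ∀ o e νy νx G → o * (q 3 * e - q 3 * νy) * G + (- (q 6 * o)) * (νx * G)
                              ≡ o * (q 3 * e - q 3 * νy - q 6 * νx) * G
    collect = solve-∀ ℚ-ring

    pointwise : ∀ n → bNum (q D) y * (A (y + 1ℚ) n * w n) + cNum (q D) y * (A (y - 1ℚ) n * w n)
                      ≡ α * (A y n * w n) + β * (Λ n * w n)
    pointwise n = begin
      bNum (q D) y * (A (y + 1ℚ) n * w n) + cNum (q D) y * (A (y - 1ℚ) n * w n)
        ≡⟨ distrib (bNum (q D) y) (cNum (q D) y) (A (y + 1ℚ) n) (A (y - 1ℚ) n) (w n) ⟩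
      (bNum (q D) y * A (y + 1ℚ) n + cNum (q D) y * A (y - 1ℚ) n) * w n
        ≡⟨ cong (_* w n) (A-contiguous (q D) y n) ⟩
      odd y * ((q 3 * E (q D) - q 3 * pronic y) * A y n - q 6 * Λ n) * w n
        ≡⟨ redistrib (odd y) (q 3 * E (q D) - q 3 * pronic y) (A y n) (Λ n) (w n) ⟩
      α * (A y n * w n) + β * (Λ n * w n) ∎

-- The coefficients b, c, a, θ and k in closed form

q-odd : ∀ j → q (2 ℕ.* j ℕ.+ 1) ≡ odd (q j)
q-odd j = trans (q-+ (2 ℕ.* j) 1) (cong (_+ 1ℚ) (q-* 2 j))

q-E : ∀ D → q D * q (D ℕ.+ 2) ≡ E (q D)
q-E D = cong (q D *_) (q-+ D 2)

b-closed : ∀ {D j} → j ≤ D → b D j ≡ bNum (q D) (q j) ÷ (E (q D) * odd (q j))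
b-closed {D} {j} j≤D = cong₂ _÷_ numerator (cong₂ _*_ (q-E D) (q-odd j))
  where
  numerator : q 3 * q (D ℕ.∸ j) * q (j ℕ.+ 1) * q (D ℕ.+ j ℕ.+ 2) ≡ bNum (q D) (q j)
  numerator = cong₂ _*_ (cong₂ _*_ (cong (q 3 *_) (q-∸ j≤D)) (q-+ j 1))
                        (trans (q-+ (D ℕ.+ j) 2) (cong (_+ q 2) (q-+ D j)))

c-closed : ∀ {D j} → j ≤ D → c D j ≡ cNum (q D) (q j) ÷ (E (q D) * odd (q j))
c-closed {D} {j} j≤D = cong₂ _÷_ numerator (cong₂ _*_ (q-E D) (q-odd j))
  where
  numerator : q 3 * q (D ℕ.∸ j ℕ.+ 1) * q j * q (D ℕ.+ j ℕ.+ 1) ≡ cNum (q D) (q j)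
  numerator = cong₂ _*_ (cong (λ z → q 3 * z * q j) (trans (q-+ (D ℕ.∸ j) 1) (cong (_+ q 1) (q-∸ j≤D))))
                        (trans (q-+ (D ℕ.+ j) 1) (cong (_+ q 1) (q-+ D j)))

a-closed : ∀ D j → a D j ≡ (q 3 * pronic (q j)) ÷ E (q D)
a-closed D j = cong₂ _÷_ (trans (*-assoc (q 3) (q j) (q (j ℕ.+ 1))) (cong (λ z → q 3 * (q j * z)) (q-+ j 1))) (q-E D)

E-≢0 : ∀ {D} → 0 < D → E (q D) ≢ 0ℚ
E-≢0 {D} 0<D = p*r≢0 (q-≢0 0<D) (subst (_≢ 0ℚ) (q-+ D 2) (q-≢0 (0<m+[1+n] D 1)))

odd-≢0 : ∀ j → odd (q j) ≢ 0ℚ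
odd-≢0 j = subst (_≢ 0ℚ) (q-odd j) (q-≢0 (0<m+[1+n] (2 ℕ.* j) 0))

θ-a-closed : ∀ {D} → 0 < D → ∀ i j →
  θ D i - a D j ≡ (q 3 * E (q D) - q 3 * pronic (q j) - q 6 * pronic (q i)) ÷ E (q D)
θ-a-closed {D} 0<D i j = begin
  q 3 - q 2 * a D i - a D j
    ≡⟨ cong₂ (λ aᵢ aⱼ → q 3 - q 2 * aᵢ - aⱼ) (a-closed D i) (a-closed D j) ⟩
  q 3 - q 2 * (q 3 * pronic (q i) * inv e) - q 3 * pronic (q j) * inv e
    ≡⟨ cong (λ z → q 3 * z - q 2 * (q 3 * pronic (q i) * inv e) - q 3 * pronic (q j) * inv e) (p*inv[p]≡1 e (E-≢0 0<D)) ⟨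
  q 3 * (e * inv e) - q 2 * (q 3 * pronic (q i) * inv e) - q 3 * pronic (q j) * inv e
    ≡⟨ factor e (inv e) (pronic (q i)) (pronic (q j)) ⟩
  (q 3 * e - q 3 * pronic (q j) - q 6 * pronic (q i)) * inv e ∎
  where
  e = E (q D)
  factor : ∀ e ι νᵢ νⱼ → q 3 * (e * ι) - q 2 * (q 3 * νᵢ * ι) - q 3 * νⱼ * ι ≡ (q 3 * e - q 3 * νⱼ - q 6 * νᵢ) * ι
  factor = solve-∀ ℚ-ring

denominator-≢0 : ∀ {D} j → 0 < D → q D * q (D ℕ.+ 2) * q (2 ℕ.* j ℕ.+ 1) ≢ 0ℚ
denominator-≢0 {D} j 0<D = p*r≢0 (p*r≢0 (q-≢0 0<D) (q-≢0 (0<m+[1+n] D 1))) (q-≢0 (0<m+[1+n] (2 ℕ.* j) 0))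

b-≢0 : ∀ {D j} → j < D → b D j ≢ 0ℚ
b-≢0 {D} {j} j<D = p÷r≢0
  (p*r≢0 (p*r≢0 (p*r≢0 (q-≢0 {3} ℕ.z<s) (q-≢0 (ℕ.m<n⇒0<n∸m j<D))) (q-≢0 (0<m+[1+n] j 0))) (q-≢0 (0<m+[1+n] (D ℕ.+ j) 1)))
  (denominator-≢0 j (ℕ.≤-trans (s≤s z≤n) j<D))

c-≢0 : ∀ {D j} → 0 < j → j ≤ D → c D j ≢ 0ℚ
c-≢0 {D} {j} 0<j j≤D = p÷r≢0
  (p*r≢0 (p*r≢0 (p*r≢0 (q-≢0 {3} ℕ.z<s) (q-≢0 (0<m+[1+n] (D ℕ.∸ j) 0))) (q-≢0 0<j)) (q-≢0 (0<m+[1+n] (D ℕ.+ j) 0)))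
  (denominator-≢0 j (ℕ.<-≤-trans 0<j j≤D))

b0≡3 : ∀ {D} → 0 < D → b D 0 ≡ q 3
b0≡3 {D} 0<D = begin
  b D 0                              ≡⟨ b-closed {D} z≤n ⟩
  bNum (q D) (q 0) * inv (e * 1ℚ)    ≡⟨ cong₂ (λ n z → n * inv z) (bNum-at-0 (q D)) (*-identityʳ e) ⟩
  q 3 * e * inv e                    ≡⟨ *-assoc (q 3) e (inv e) ⟩
  q 3 * (e * inv e)                  ≡⟨ cong (q 3 *_) (p*inv[p]≡1 e (E-≢0 0<D)) ⟩
  q 3 * 1ℚ                           ≡⟨ *-identityʳ (q 3) ⟩
  q 3                                ∎
  where
  e = E (q D)
  bNum-at-0 : ∀ d → q 3 * (d - q 0) * (q 0 + 1ℚ) * (d + q 0 + q 2) ≡ q 3 * (d * (d + q 2))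
  bNum-at-0 = solve-∀ ℚ-ring

a0≡0 : ∀ D → a D 0 ≡ 0ℚ
a0≡0 D = *-zeroˡ (inv (q D * q (D ℕ.+ 2)))

c0≡0 : ∀ D → c D 0 ≡ 0ℚ
c0≡0 D = vanish (q (D ℕ.∸ 0 ℕ.+ 1)) (q (D ℕ.+ 0 ℕ.+ 1)) (inv (q D * q (D ℕ.+ 2) * q 1))
  where
  vanish : ∀ u v ι → q 3 * u * q 0 * v * ι ≡ 0ℚ
  vanish = solve-∀ ℚ-ring
bNum≡cNum-suc : ∀ d y → bNum d y ≡ cNum d (y + 1ℚ)
bNum≡cNum-suc = identity
  where
  identity : ∀ d y → q 3 * (d - y) * (y + 1ℚ) * (d + y + q 2) ≡ q 3 * (d - (y + 1ℚ) + 1ℚ) * (y + 1ℚ) * (d + (y + 1ℚ) + 1ℚ)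
  identity = solve-∀ ℚ-ring

b*odd≡c*odd : ∀ {D m} → m < D → b D m * q (2 ℕ.* m ℕ.+ 1) ≡ c D (suc m) * q (2 ℕ.* suc m ℕ.+ 1)
b*odd≡c*odd {D} {m} m<D = begin
  b D m * q (2 ℕ.* m ℕ.+ 1)
    ≡⟨ cong₂ _*_ (b-closed (ℕ.<⇒≤ m<D)) (q-odd m) ⟩
  (bNum d (q m) ÷ (E d * odd (q m))) * odd (q m)
    ≡⟨ p÷[r*s]*s≡p÷r (bNum d (q m)) (E d) (odd-≢0 m) ⟩
  bNum d (q m) ÷ E d
    ≡⟨ cong (_÷ E d) (trans (bNum≡cNum-suc d (q m)) (sym (cong (cNum d) (q-suc m)))) ⟩
  cNum d (q (suc m)) ÷ E d
    ≡⟨ p÷[r*s]*s≡p÷r (cNum d (q (suc m))) (E d) (odd-≢0 (suc m)) ⟨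
  (cNum d (q (suc m)) ÷ (E d * odd (q (suc m)))) * odd (q (suc m))
    ≡⟨ cong₂ _*_ (c-closed m<D) (q-odd (suc m)) ⟨
  c D (suc m) * q (2 ℕ.* suc m ℕ.+ 1) ∎
  where
  d = q D

prodB≡odd*prodC : ∀ {D j} → j ≤ D → prodB D j ≡ q (2 ℕ.* j ℕ.+ 1) * prodC D j
prodB≡odd*prodC {D} {zero}  _   = refl
prodB≡odd*prodC {D} {suc m} m<D = begin
  prodB D m * b D m
    ≡⟨ cong (_* b D m) (prodB≡odd*prodC (ℕ.<⇒≤ m<D)) ⟩
  q (2 ℕ.* m ℕ.+ 1) * prodC D m * b D m
    ≡⟨ regroup (q (2 ℕ.* m ℕ.+ 1)) (prodC D m) (b D m) ⟩
  prodC D m * (b D m * q (2 ℕ.* m ℕ.+ 1))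
    ≡⟨ cong (prodC D m *_) (b*odd≡c*odd m<D) ⟩
  prodC D m * (c D (suc m) * q (2 ℕ.* suc m ℕ.+ 1))
    ≡⟨ regroup′ (prodC D m) (c D (suc m)) (q (2 ℕ.* suc m ℕ.+ 1)) ⟩
  q (2 ℕ.* suc m ℕ.+ 1) * (prodC D m * c D (suc m)) ∎
  where
  regroup : ∀ o p β → o * p * β ≡ p * (β * o)
  regroup = solve-∀ ℚ-ring
  regroup′ : ∀ p γ o → p * (γ * o) ≡ o * (p * γ)
  regroup′ = solve-∀ ℚ-ring

prodC-≢0 : ∀ {D j} → j ≤ D → prodC D j ≢ 0ℚ
prodC-≢0 {D} {zero}  _   = 1≢0
prodC-≢0 {D} {suc m} m<D = p*r≢0 (prodC-≢0 (ℕ.<⇒≤ m<D)) (c-≢0 ℕ.z<s m<D)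

k-closed : ∀ {D j} → j ≤ D → k D j ≡ q (2 ℕ.* j ℕ.+ 1)
k-closed {D} {j} j≤D = begin
  prodB D j * inv (prodC D j)                          ≡⟨ cong (_* inv (prodC D j)) (prodB≡odd*prodC j≤D) ⟩
  q (2 ℕ.* j ℕ.+ 1) * prodC D j * inv (prodC D j)      ≡⟨ *-assoc (q (2 ℕ.* j ℕ.+ 1)) (prodC D j) (inv (prodC D j)) ⟩
  q (2 ℕ.* j ℕ.+ 1) * (prodC D j * inv (prodC D j))    ≡⟨ cong (q (2 ℕ.* j ℕ.+ 1) *_) (p*inv[p]≡1 (prodC D j) (prodC-≢0 j≤D)) ⟩
  q (2 ℕ.* j ℕ.+ 1) * 1ℚ                               ≡⟨ *-identityʳ (q (2 ℕ.* j ℕ.+ 1)) ⟩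
  q (2 ℕ.* j ℕ.+ 1)                                    ∎

R-step : ∀ {D i j} → i ≤ D → j < D →
  R D (q i) (q (suc j)) ≡ ((θ D i - a D j) * R D (q i) (q j) - c D j * R D (q i) (q j - 1ℚ)) ÷ b D j
R-step {D} {i} {j} i≤D j<D = p*s≡t⇒s≡t÷p (b-≢0 j<D) (begin
  b D j * R D x (q (suc j))
    ≡⟨ cong₂ _*_ (b-closed (ℕ.<⇒≤ j<D)) (cong (R D x) (q-suc j)) ⟩
  (bNum (q D) y ÷ (E (q D) * odd y)) * R D x (y + 1ℚ)
    ≡⟨ recurrence-÷ (E (q D)) (bNum (q D) y) (cNum (q D) y) (odd-≢0 j) (R-recurrence D i≤D y) ⟩
  ((q 3 * E (q D) - q 3 * pronic y - q 6 * pronic x) ÷ E (q D)) * R D x y - (cNum (q D) y ÷ (E (q D) * odd y)) * R D x (y - 1ℚ)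
    ≡⟨ cong₂ (λ α γ → α * R D x y - γ * R D x (y - 1ℚ)) (θ-a-closed (ℕ.≤-trans (s≤s z≤n) j<D) i j) (c-closed (ℕ.<⇒≤ j<D)) ⟨
  (θ D i - a D j) * R D x y - c D j * R D x (y - 1ℚ) ∎)
  where
  x = q i
  y = q j

u-closed : ∀ {D i} → 0 < D → i ≤ D → ∀ {j} → j ≤ D → u D j (θ D i) ≡ R D (q i) (q j)
u-closed {D} {i} 0<D i≤D {zero} _ = sym (R-at-0 D (q i))
u-closed {D} {i} 0<D i≤D {suc zero} _ = sym (begin
  R D (q i) (q 1)
    ≡⟨ R-step i≤D 0<D ⟩
  ((θ D i - a D 0) * R D (q i) (q 0) - c D 0 * R₋) ÷ b D 0
    ≡⟨ cong₂ (λ α γ → ((θ D i - α) * R D (q i) (q 0) - γ * R₋) ÷ b D 0) (a0≡0 D) (c0≡0 D) ⟩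
  ((θ D i - 0ℚ) * R D (q i) (q 0) - 0ℚ * R₋) ÷ b D 0
    ≡⟨ cong₂ (λ g β → ((θ D i - 0ℚ) * g - 0ℚ * R₋) ÷ β) (R-at-0 D (q i)) (b0≡3 0<D) ⟩
  ((θ D i - 0ℚ) * 1ℚ - 0ℚ * R₋) ÷ q 3
    ≡⟨ cong (_÷ q 3) (simplify (θ D i) R₋) ⟩
  θ D i ÷ q 3 ∎)
  where
  R₋ = R D (q i) (q 0 - 1ℚ)
  simplify : ∀ t g → (t - 0ℚ) * 1ℚ - 0ℚ * g ≡ t
  simplify = solve-∀ ℚ-ring
u-closed {D} {i} 0<D i≤D {suc (suc j)} j+2≤D = begin
  ((θ D i - a D (suc j)) * u D (suc j) (θ D i) - c D (suc j) * u D j (θ D i)) ÷ b D (suc j)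
    ≡⟨ cong₂ (λ u₁ u₀ → ((θ D i - a D (suc j)) * u₁ - c D (suc j) * u₀) ÷ b D (suc j))
             (u-closed 0<D i≤D (ℕ.<⇒≤ j+2≤D))
             (trans (u-closed 0<D i≤D (ℕ.<⇒≤ (ℕ.<⇒≤ j+2≤D))) (cong (R D (q i)) q[j]≡q[1+j]-1)) ⟩
  ((θ D i - a D (suc j)) * R D (q i) (q (suc j)) - c D (suc j) * R D (q i) (q (suc j) - 1ℚ)) ÷ b D (suc j)
    ≡⟨ R-step i≤D j+2≤D ⟨
  R D (q i) (q (suc (suc j))) ∎
  where
  cancel : ∀ a → a ≡ a + 1ℚ - 1ℚ
  cancel = solve-∀ ℚ-ring
  q[j]≡q[1+j]-1 : q j ≡ q (suc j) - 1ℚ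
  q[j]≡q[1+j]-1 = trans (cancel (q j)) (cong (_- 1ℚ) (sym (q-suc j)))

F43-at-1 : ∀ N a₁ a₂ a₃ a₄ b₁ b₂ b₃ →
  F43 N a₁ a₂ a₃ a₄ b₁ b₂ b₃ 1ℚ
  ≡ sumTo (suc N) (λ n → poch a₃ n * poch a₄ n * ((poch a₁ n * poch a₂ n) ÷ (poch b₁ n * poch b₂ n * poch b₃ n * fact n)))
-- The powers z^n are computed by a function local to F43, reachable only through its equations.
F43-at-1 N a₁ a₂ a₃ a₄ b₁ b₂ b₃ = powers-of-one _ refl (λ _ → refl)
  where
  regroup : ∀ p₁ p₂ p₃ p₄ ι → p₁ * p₂ * p₃ * p₄ * 1ℚ * ι ≡ p₃ * p₄ * (p₁ * p₂ * ι)
  regroup = solve-∀ ℚ-ring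
  powers-of-one : ∀ (pow : ℕ → ℚ) → pow 0 ≡ 1ℚ → (∀ n → pow (suc n) ≡ pow n * 1ℚ) →
    sumTo (suc N) (λ n → (poch a₁ n * poch a₂ n * poch a₃ n * poch a₄ n * pow n) ÷ (poch b₁ n * poch b₂ n * poch b₃ n * fact n))
    ≡ sumTo (suc N) (λ n → poch a₃ n * poch a₄ n * ((poch a₁ n * poch a₂ n) ÷ (poch b₁ n * poch b₂ n * poch b₃ n * fact n)))
  powers-of-one pow pow[0]≡1 pow-suc = sumTo-cong (suc N) λ n _ →
    trans (cong (λ z → (poch a₁ n * poch a₂ n * poch a₃ n * poch a₄ n * z) ÷ (poch b₁ n * poch b₂ n * poch b₃ n * fact n)) (pow≡1 n))
          (regroup (poch a₁ n) (poch a₂ n) (poch a₃ n) (poch a₄ n) (inv (poch b₁ n * poch b₂ n * poch b₃ n * fact n)))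
    where
    pow≡1 : ∀ n → pow n ≡ 1ℚ
    pow≡1 zero    = pow[0]≡1
    pow≡1 (suc n) = trans (pow-suc n) (cong (_* 1ℚ) (pow≡1 n))

P-closed : ∀ D i j → P D i j ≡ q (2 ℕ.* j ℕ.+ 1) * R D (q i) (q j)
P-closed D i j = cong (q (2 ℕ.* j ℕ.+ 1) *_) F43≡R
  where
  F43≡R : F43 D (- q i) (q (i ℕ.+ 1)) (- q j) (q (j ℕ.+ 1)) 1ℚ (q (D ℕ.+ 2)) (- q D) 1ℚ ≡ R D (q i) (q j)
  F43≡R rewrite q-+ i 1 | q-+ j 1 | q-+ D 2 = F43-at-1 D _ _ _ _ _ _ _

lemma3p5 : (D : ℕ) → 1 ≤ D → (i j : ℕ) → i ≤ D → j ≤ D →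
    P D i j ≡ v D j (θ D i)
lemma3p5 D 1≤D i j i≤D j≤D = begin
  P D i j                               ≡⟨ P-closed D i j ⟩
  q (2 ℕ.* j ℕ.+ 1) * R D (q i) (q j)   ≡⟨ cong₂ _*_ (k-closed j≤D) (u-closed 1≤D i≤D j≤D) ⟨
  k D j * u D j (θ D i)                 ∎
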